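{- Let $n$ be a positive integer and let $X = \mathrm{Cay}(\mathbb{Z}_n, S)$ be a circulant graph. Choose nontrivial subgroups $H$ and $K$ of $\mathbb{Z}_n$ such that $|K|$ is even, and let $K_o = K \setminus 2K$. Suppose that either (1) $S + H \subseteq S \cup (K_o + H)$ and $H \cap K_o = \emptyset$, or (2) $(S \setminus K_o) + H \subseteq S \cup K_o$, and either $|H| \neq 2$ or $|K|$ is divisible by $4$. Then $X$ is unstable.
   Context: All graphs are finite, simple and undirected. For an abelian group $G$ and a subset $S \subseteq G$ with $-S = S$ and $0 \notin S$, the Cayley graph $\mathrm{Cay}(G,S)$ has vertex set $G$, with $v$ adjacent to $w$ iff $w - v \in S$. A circulant graph is a Cayley graph on $\mathbb{Z}_n$. For $A \subseteq \mathbb{Z}_n$ and $g \in \mathbb{Z}_n$, $A + H = \{a + h : a \in A, h \in H\}$ and $2K = \{2k : k \in K\}$. The canonical bipartite double cover $BX$ of a graph $X$ has vertex set $V(X) \times \{0,1\}$, with $(v,0)$ adjacent to $(w,1)$ iff $v$ is adjacent to $w$ in $X$ (and no other edges). The group $\mathrm{Aut}\,X \times S_2$ (with $S_2$ the symmetric group on $\{0,1\}$) acts on $BX$ by $(\varphi,\sigma)(v,i) = (\varphi(v), \sigma(i))$, and so is a subgroup of $\mathrm{Aut}\,BX$. A graph $X$ is unstable if $\mathrm{Aut}\,BX \neq \mathrm{Aut}\,X \times S_2$. -}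

module Defs where

open import Data.Nat using (ℕ; _+_; _∸_; NonZero)
open import Data.Nat.DivMod using (_mod_)
open import Data.Fin using (Fin; toℕ)
open import Data.Fin.Subset as Sub using (Subset)
open import Data.Bool using (Bool; not)
open import Data.Product using (_×_; ∃; ∃-syntax; _,_)
open import Data.Empty using (⊥)
open import Relation.Nullary using (¬_)
open import Relation.Binary.PropositionalEquality using (_≡_; _≢_)
open import Function.Definitions using (Bijective)
open import Function.Bundles using (_⇔_)
open import Level using (0ℓ)
open import Relation.Unary using (Pred)

module _ {n : ℕ} .{{_ : NonZero n}} where

  0ℤ : Fin n
  0ℤ = 0 mod n

  infixl 6 _⊕_ _⊖_
  _⊕_ : Fin n → Fin n → Fin n
  a ⊕ b = (toℕ a + toℕ b) mod n

  ⊖_ : Fin n → Fin n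
  ⊖ a = (n ∸ toℕ a) mod n

  _⊖_ : Fin n → Fin n → Fin n
  a ⊖ b = a ⊕ (⊖ b)

  ⟦_⟧ : Subset n → Pred (Fin n) 0ℓ
  ⟦ A ⟧ x = x Sub.∈ A

  _+ˢ_ : Pred (Fin n) 0ℓ → Pred (Fin n) 0ℓ → Pred (Fin n) 0ℓ
  (A +ˢ B) x = ∃[ a ] ∃[ b ] (A a × B b × x ≡ a ⊕ b)

  twice : Pred (Fin n) 0ℓ → Pred (Fin n) 0ℓ
  twice K x = ∃[ k ] (K k × x ≡ k ⊕ k)

  odd-part : Pred (Fin n) 0ℓ → Pred (Fin n) 0ℓ
  odd-part K x = K x × ¬ twice K x

  IsSubgroup : Subset n → Set
  IsSubgroup H = (0ℤ Sub.∈ H)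
               × (∀ a b → a Sub.∈ H → b Sub.∈ H → (a ⊕ b) Sub.∈ H)
               × (∀ a → a Sub.∈ H → (⊖ a) Sub.∈ H)

  Nontrivial : Subset n → Set
  Nontrivial H = ∃[ h ] (h Sub.∈ H × h ≢ 0ℤ)

  IsConnectionSet : Subset n → Set
  IsConnectionSet S = (∀ s → s Sub.∈ S → (⊖ s) Sub.∈ S) × ¬ (0ℤ Sub.∈ S)

  CayAdj : Subset n → Fin n → Fin n → Set
  CayAdj S v w = (w ⊖ v) Sub.∈ S

IsAutomorphism : {V : Set} → (V → V → Set) → (V → V) → Set
IsAutomorphism {V} adj f = Bijective _≡_ _≡_ f × (∀ u v → adj u v ⇔ adj (f u) (f v))

-- canonical bipartite double cover; {0,1} represented by Bool
BAdj : {V : Set} → (V → V → Set) → (V × Bool) → (V × Bool) → Set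
BAdj adj (v , i) (w , j) = (i ≡ not j) × adj v w

InAutXS2 : {V : Set} → (V → V → Set) → (V × Bool → V × Bool) → Set
InAutXS2 {V} adj f = ∃[ φ ] ∃[ σ ] (IsAutomorphism adj φ × Bijective _≡_ _≡_ σ
                         × (∀ v i → f (v , i) ≡ (φ v , σ i)))

-- X is unstable: Aut BX ≠ Aut X × S₂, i.e. some automorphism of BX is
-- not of the form (φ , σ) with φ ∈ Aut X, σ ∈ S₂.
Unstable : {V : Set} → (V → V → Set) → Set
Unstable adj = ∃[ f ] (IsAutomorphism (BAdj adj) f × ¬ InAutXS2 adj f)

-- Let γ be the least nonzero element of K; as |K| is even, γ ∉ 2K, and K_o + K_o ⊆ 2K.
-- Take C = 2K + H in case (1) and C = 2K in case (2), so that γ ∉ C, and a nonzero h ∈ H.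
-- Let g be the permutation of ℤₙ that translates the coset C by h, maps C + h back by -h,
-- and fixes everything else.  Then
--   (v, 0) ↦ (g v, 0),   (v, 1) ↦ (g (v + γ) - γ, 1)
-- is an automorphism of BX.  For an edge (v,0)(w,1) put u = w + γ: if u - v ∈ C, then g
-- preserves the difference u - v; otherwise neither w - v nor its image lies in the bad set
-- B = K_o + H (resp. K_o), since B + γ ⊆ C, and the two differ by an element of H, so the
-- hypothesis on S puts both or neither in S.  It is not in Aut X × S₂ because g 0 + γ ≠ g γ.
-- In case (2) this needs h ≠ -h when γ - h ∈ 2K; such an h exists unless H = {0, h} with
-- h ∈ K_o of order 2, which forces |H| = 2 and |K| ≡ 2 (mod 4).

{-# OPTIONS --safe #-}
module Submission where

open import Defs
open import Algebra.Bundles using (AbelianGroup)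
open import Data.Bool using (Bool; true; false; if_then_else_)
open import Data.Empty using (⊥; ⊥-elim)
open import Data.Fin using (Fin; toℕ; zero; suc; Fin′; inject; fromℕ<)
open import Data.Fin.Properties using (toℕ-injective; toℕ-fromℕ<; toℕ<n; toℕ-inject; any?; _≟_; ¬∀⟶∃¬-smallest)
open import Data.Fin.Subset using (Subset; _∈_; ∣_∣; inside; outside)
open import Data.Fin.Subset.Properties using (_∈?_; drop-there)
open import Data.Nat as ℕ using (ℕ; zero; suc; _+_; _*_; _∸_; _≤_; _<_; z≤n; s≤s; NonZero; _%_; _/_)
open import Data.Nat.DivMod using (_mod_; m%n<n; %-distribˡ-+; m≡m%n+[m/n]*n; n%n≡0; m<n⇒m%n≡m)
open import Data.Nat.Divisibility
  using (_∣_; _∣?_; divides; _∣0; ∣-refl; ∣⇒≤; ∣m∣n⇒∣m+n; ∣m+n∣m⇒∣n; m%n≡0⇒n∣m; %-presˡ-∣)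
open _∣_ using (quotient; equality)
open import Data.Nat.Properties
  using (+-assoc; +-comm; +-identityʳ; *-assoc; *-identityˡ; *-distribʳ-+; *-cancelʳ-≡; m+n≡0⇒m≡0;
         <⇒≤; <⇒≱; <-trans; m<m+n; m≤m+n; +-mono-<; +-monoʳ-≤; m+[n∸m]≡n)
open import Data.Nat.Tactic.RingSolver using (solve-∀)
open import Data.Product using (_×_; _,_; proj₁; proj₂; ∃; ∃-syntax)
open import Data.Product.Function.NonDependent.Propositional using (_×-⇔_)
open import Data.Sum using (_⊎_; inj₁; inj₂; [_,_])
open import Data.Vec using (_∷_; []; here; there)
open import Function using (_∘_; case_of_)
open import Function.Bundles using (_⇔_; mk⇔; mk↔ₛ′; Bijection; Equivalence)
open import Function.Construct.Composition using (_⇔-∘_)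
open import Function.Construct.Identity using (⇔-id)
open import Function.Definitions using (StrictlyInverseˡ; StrictlyInverseʳ; Bijective)
open import Function.Properties.Inverse using (↔⇒⤖)
open import Level using (0ℓ)
open import Relation.Binary.PropositionalEquality
  using (_≡_; _≢_; refl; sym; trans; cong; cong₂; subst; subst₂; isEquivalence; module ≡-Reasoning)
open import Relation.Nullary using (¬_; Dec; yes; no; does)
open import Relation.Nullary.Decidable using (_×-dec_; ¬?; _→-dec_; dec-true; dec-false; decidable-stable)
open import Relation.Unary using (Pred; Decidable; _⊆_; _∪_; _∖_; _∩_; ∅)

-- Arithmetic in ℕ

¬2∣m⇒m%2≡1 : ∀ m → ¬ 2 ∣ m → m % 2 ≡ 1
¬2∣m⇒m%2≡1 m ¬2∣m with m % 2 in eq | m%n<n m 2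
... | zero        | _ = ⊥-elim (¬2∣m (m%n≡0⇒n∣m m 2 eq))
... | suc zero    | _ = refl
... | suc (suc _) | s≤s (s≤s ())

¬2∣m⇒¬2∣n⇒2∣m+n : ∀ m n → ¬ 2 ∣ m → ¬ 2 ∣ n → 2 ∣ m + n
¬2∣m⇒¬2∣n⇒2∣m+n m n ¬2∣m ¬2∣n = m%n≡0⇒n∣m (m + n) 2
  (trans (%-distribˡ-+ m n 2) (cong₂ (λ x y → (x + y) % 2) (¬2∣m⇒m%2≡1 m ¬2∣m) (¬2∣m⇒m%2≡1 n ¬2∣n)))

m*[2*n]≡m*n+m*n : ∀ m n → m * (2 * n) ≡ m * n + m * n
m*[2*n]≡m*n+m*n = solve-∀

m+m≡c*4⇒2∣m : ∀ m c → m + m ≡ c * 4 → 2 ∣ m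
m+m≡c*4⇒2∣m m c eq = divides c (*-cancelʳ-≡ m (c * 2) 2 (trans (m*2≡m+m m) (trans eq (c*4≡c*2*2 c))))
  where
  m*2≡m+m : ∀ m → m * 2 ≡ m + m
  m*2≡m+m = solve-∀
  c*4≡c*2*2 : ∀ c → c * 4 ≡ c * 2 * 2
  c*4≡c*2*2 = solve-∀

count< : (ℕ → Bool) → ℕ → ℕ
count< f zero    = 0
count< f (suc N) = (if f 0 then 1 else 0) + count< (f ∘ suc) N

∈-tail : ∀ {n} {P : Pred ℕ 0ℓ} {x} {p : Subset n} → (∀ i → i ∈ x ∷ p ⇔ P (toℕ i)) →
         ∀ i → i ∈ p ⇔ P (suc (toℕ i))
∈-tail mem i = mk⇔ (Equivalence.to (mem (suc i)) ∘ there) (drop-there ∘ Equivalence.from (mem (suc i)))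

∣p∣≡count< : ∀ {n} {P : Pred ℕ 0ℓ} (P? : Decidable P) (p : Subset n) →
             (∀ i → i ∈ p ⇔ P (toℕ i)) → ∣ p ∣ ≡ count< (does ∘ P?) n
∣p∣≡count< P? []            mem = refl
∣p∣≡count< {P = P} P? (inside ∷ p)  mem rewrite dec-true (P? 0) (Equivalence.to (mem zero) here) =
  cong suc (∣p∣≡count< (P? ∘ suc) p (∈-tail {P = P} mem))
∣p∣≡count< {P = P} P? (outside ∷ p) mem
  rewrite dec-false (P? 0) (λ P0 → case Equivalence.from (mem zero) P0 of λ ()) =
  ∣p∣≡count< (P? ∘ suc) p (∈-tail {P = P} mem)

count<-+ : ∀ f a b → count< f (a + b) ≡ count< f a + count< (λ v → f (a + v)) b
count<-+ f zero    b = refl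
count<-+ f (suc a) b = trans (cong ((if f 0 then 1 else 0) +_) (count<-+ (f ∘ suc) a b))
                             (sym (+-assoc (if f 0 then 1 else 0) _ _))

count<-cong : ∀ {f f′} N → (∀ v → f v ≡ f′ v) → count< f N ≡ count< f′ N
count<-cong zero    eq = refl
count<-cong (suc N) eq = cong₂ _+_ (cong (λ b → if b then 1 else 0) (eq 0)) (count<-cong N (eq ∘ suc))

count<-none : ∀ f N → (∀ v → v < N → f v ≡ false) → count< f N ≡ 0
count<-none f zero    none = refl
count<-none f (suc N) none rewrite none 0 (s≤s z≤n) = count<-none (f ∘ suc) N (λ v v<N → none (suc v) (s≤s v<N))

count<-multiples : ∀ g .{{_ : NonZero g}} m → count< (λ v → does (g ∣? v)) (m * g) ≡ m
count<-multiples g         zero    = refl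
count<-multiples g@(suc g′) (suc m) = begin
  count< multiple (g + m * g)
    ≡⟨ count<-+ multiple g (m * g) ⟩
  count< multiple g + count< (λ v → multiple (g + v)) (m * g)
    ≡⟨ cong₂ _+_ first-block (count<-cong (m * g) shift) ⟩
  1 + count< multiple (m * g)
    ≡⟨ cong suc (count<-multiples g m) ⟩
  suc m
    ∎
  where
  open ≡-Reasoning
  multiple : ℕ → Bool
  multiple v = does (g ∣? v)
  first-block : count< multiple g ≡ 1
  first-block rewrite dec-true (g ∣? 0) (g ∣0) =
    cong suc (count<-none (multiple ∘ suc) g′
      (λ v v<g′ → dec-false (g ∣? suc v) (λ g∣1+v → <⇒≱ (s≤s v<g′) (∣⇒≤ g∣1+v))))
  shift : ∀ v → multiple (g + v) ≡ multiple v
  shift v = by-cases (g ∣? v)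
    where
    by-cases : Dec (g ∣ v) → multiple (g + v) ≡ multiple v
    by-cases (yes g∣v) = trans (dec-true (g ∣? (g + v)) (∣m∣n⇒∣m+n ∣-refl g∣v))
                               (sym (dec-true (g ∣? v) g∣v))
    by-cases (no ¬g∣v) = trans (dec-false (g ∣? (g + v)) (λ g∣g+v → ¬g∣v (∣m+n∣m⇒∣n g∣g+v ∣-refl)))
                               (sym (dec-false (g ∣? v) ¬g∣v))

module _ {n : ℕ} .{{_ : NonZero n}} where

  -- ℤₙ as an abelian group

  toℕ-mod : ∀ m → toℕ (m mod n) ≡ m % n
  toℕ-mod m = toℕ-fromℕ< (m%n<n m n)

  toℕ-0ℤ : toℕ (0ℤ {n}) ≡ 0
  toℕ-0ℤ = trans (toℕ-mod 0) (m<n⇒m%n≡m (ℕ.>-nonZero⁻¹ n))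

  toℕ-mod-id : ∀ (x : Fin n) → toℕ x mod n ≡ x
  toℕ-mod-id x = toℕ-injective (trans (toℕ-mod (toℕ x)) (m<n⇒m%n≡m (toℕ<n x)))

  mod-+ : ∀ a b → (a mod n) ⊕ (b mod n) ≡ (a + b) mod n
  mod-+ a b = toℕ-injective (begin
    toℕ ((a mod n) ⊕ (b mod n))          ≡⟨ toℕ-mod (toℕ (a mod n) + toℕ (b mod n)) ⟩
    (toℕ (a mod n) + toℕ (b mod n)) % n  ≡⟨ cong₂ (λ x y → (x + y) % n) (toℕ-mod a) (toℕ-mod b) ⟩
    (a % n + b % n) % n                  ≡⟨ %-distribˡ-+ a b n ⟨
    (a + b) % n                          ≡⟨ toℕ-mod (a + b) ⟨
    toℕ ((a + b) mod n)                  ∎)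
    where open ≡-Reasoning

  ⊕-comm : ∀ (a b : Fin n) → a ⊕ b ≡ b ⊕ a
  ⊕-comm a b = cong (_mod n) (+-comm (toℕ a) (toℕ b))

  ⊕-assoc : ∀ (a b c : Fin n) → (a ⊕ b) ⊕ c ≡ a ⊕ (b ⊕ c)
  ⊕-assoc a b c = begin
    (a ⊕ b) ⊕ c                          ≡⟨ cong ((a ⊕ b) ⊕_) (toℕ-mod-id c) ⟨
    (a ⊕ b) ⊕ (toℕ c mod n)              ≡⟨ mod-+ (toℕ a + toℕ b) (toℕ c) ⟩
    (toℕ a + toℕ b + toℕ c) mod n        ≡⟨ cong (_mod n) (+-assoc (toℕ a) (toℕ b) (toℕ c)) ⟩
    (toℕ a + (toℕ b + toℕ c)) mod n      ≡⟨ mod-+ (toℕ a) (toℕ b + toℕ c) ⟨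
    (toℕ a mod n) ⊕ (b ⊕ c)              ≡⟨ cong (_⊕ (b ⊕ c)) (toℕ-mod-id a) ⟩
    a ⊕ (b ⊕ c)                          ∎
    where open ≡-Reasoning

  ⊕-identityʳ : ∀ (a : Fin n) → a ⊕ 0ℤ ≡ a
  ⊕-identityʳ a = begin
    a ⊕ 0ℤ                   ≡⟨ cong (_⊕ 0ℤ) (toℕ-mod-id a) ⟨
    (toℕ a mod n) ⊕ 0ℤ       ≡⟨ mod-+ (toℕ a) 0 ⟩
    (toℕ a + 0) mod n        ≡⟨ cong (_mod n) (+-identityʳ (toℕ a)) ⟩
    toℕ a mod n              ≡⟨ toℕ-mod-id a ⟩
    a                        ∎
    where open ≡-Reasoning

  n-mod : n mod n ≡ 0ℤ
  n-mod = toℕ-injective (trans (toℕ-mod n) (trans (n%n≡0 n) (sym toℕ-0ℤ)))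

  ⊕-inverseʳ : ∀ (a : Fin n) → a ⊕ (⊖ a) ≡ 0ℤ
  ⊕-inverseʳ a = begin
    a ⊕ (⊖ a)                      ≡⟨ cong (_⊕ (⊖ a)) (toℕ-mod-id a) ⟨
    (toℕ a mod n) ⊕ (⊖ a)          ≡⟨ mod-+ (toℕ a) (n ∸ toℕ a) ⟩
    (toℕ a + (n ∸ toℕ a)) mod n    ≡⟨ cong (_mod n) (m+[n∸m]≡n (<⇒≤ (toℕ<n a))) ⟩
    n mod n                        ≡⟨ n-mod ⟩
    0ℤ                             ∎
    where open ≡-Reasoning

  ℤₙ : AbelianGroup 0ℓ 0ℓ
  ℤₙ = record
    { Carrier = Fin n ; _≈_ = _≡_ ; _∙_ = _⊕_ ; ε = 0ℤ ; _⁻¹ = ⊖_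
    ; isAbelianGroup = record
      { isGroup = record
        { isMonoid = record
          { isSemigroup = record
            { isMagma = record { isEquivalence = isEquivalence ; ∙-cong = cong₂ _⊕_ }
            ; assoc = ⊕-assoc }
          ; identity = (λ a → trans (⊕-comm 0ℤ a) (⊕-identityʳ a)) , ⊕-identityʳ }
        ; inverse = (λ a → trans (⊕-comm (⊖ a) a) (⊕-inverseʳ a)) , ⊕-inverseʳ
        ; ⁻¹-cong = cong (⊖_) }
      ; comm = ⊕-comm } }

  open AbelianGroup ℤₙ using (identityˡ; inverseʳ; commutativeSemigroup)
  open import Algebra.Properties.AbelianGroup ℤₙ
    using (⁻¹-involutive; ⁻¹-anti-homo‿-; ⁻¹-∙-comm; //-rightDividesˡ; //-rightDividesʳ;
           ∙-cancelʳ; inverseʳ-unique)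
  open import Algebra.Properties.CommutativeSemigroup commutativeSemigroup
    using (interchange; xy∙z≈xz∙y)

  ⊖-⊕-distrib : ∀ (a b c d : Fin n) → (a ⊕ b) ⊖ (c ⊕ d) ≡ (a ⊖ c) ⊕ (b ⊖ d)
  ⊖-⊕-distrib a b c d = begin
    (a ⊕ b) ⊕ (⊖ (c ⊕ d))          ≡⟨ cong ((a ⊕ b) ⊕_) (⁻¹-∙-comm c d) ⟨
    (a ⊕ b) ⊕ ((⊖ c) ⊕ (⊖ d))      ≡⟨ interchange a b (⊖ c) (⊖ d) ⟩
    (a ⊖ c) ⊕ (b ⊖ d)              ∎
    where open ≡-Reasoning

  ⊖-cancelʳ-⊕ : ∀ (a b c : Fin n) → (a ⊕ c) ⊖ (b ⊕ c) ≡ a ⊖ b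
  ⊖-cancelʳ-⊕ a b c = begin
    (a ⊕ c) ⊖ (b ⊕ c)    ≡⟨ ⊖-⊕-distrib a c b c ⟩
    (a ⊖ b) ⊕ (c ⊖ c)    ≡⟨ cong ((a ⊖ b) ⊕_) (inverseʳ c) ⟩
    (a ⊖ b) ⊕ 0ℤ         ≡⟨ ⊕-identityʳ (a ⊖ b) ⟩
    a ⊖ b                ∎
    where open ≡-Reasoning

  ⊖-interchange : ∀ (a b c d : Fin n) → (a ⊖ b) ⊖ (c ⊖ d) ≡ (a ⊖ c) ⊖ (b ⊖ d)
  ⊖-interchange a b c d = trans (⊖-⊕-distrib a (⊖ b) c (⊖ d)) (cong ((a ⊖ c) ⊕_) (⁻¹-∙-comm b (⊖ d)))

  x⊕[y⊖x]≡y : ∀ (x y : Fin n) → x ⊕ (y ⊖ x) ≡ y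
  x⊕[y⊖x]≡y x y = trans (⊕-comm x (y ⊖ x)) (//-rightDividesˡ x y)

  [x⊕y]⊖x≡y : ∀ (x y : Fin n) → (x ⊕ y) ⊖ x ≡ y
  [x⊕y]⊖x≡y x y = trans (cong (_⊖ x) (⊕-comm x y)) (//-rightDividesʳ x y)

  record IsSubgroupPred (C : Pred (Fin n) 0ℓ) : Set where
    field
      ∈-0ℤ : C 0ℤ
      ∈-⊕  : ∀ {a b} → C a → C b → C (a ⊕ b)
      ∈-⊖  : ∀ {a} → C a → C (⊖ a)

    ∈-diff : ∀ {a b} → C a → C b → C (a ⊖ b)
    ∈-diff ca cb = ∈-⊕ ca (∈-⊖ cb)

    ∈-cosetʳ : ∀ {a b} → C (a ⊖ b) → C b → C a
    ∈-cosetʳ {a} {b} cab cb = subst C (//-rightDividesˡ b a) (∈-⊕ cab cb)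

    ∈-cosetˡ : ∀ {a b} → C (a ⊖ b) → C a → C b
    ∈-cosetˡ {a} {b} cab ca = ∈-cosetʳ (subst C (⁻¹-anti-homo‿- a b) (∈-⊖ cab)) ca

  open IsSubgroupPred

  isSubgroupPred : ∀ {H : Subset n} → IsSubgroup H → IsSubgroupPred ⟦ H ⟧
  isSubgroupPred (0∈H , ⊕∈H , ⊖∈H) = record
    { ∈-0ℤ = 0∈H ; ∈-⊕ = ⊕∈H _ _ ; ∈-⊖ = ⊖∈H _ }

  twice-isSubgroupPred : ∀ {K} → IsSubgroupPred K → IsSubgroupPred (twice K)
  twice-isSubgroupPred K-sub = record
    { ∈-0ℤ = 0ℤ , ∈-0ℤ K-sub , sym (identityˡ 0ℤ)
    ; ∈-⊕  = λ { (k , kK , refl) (j , jK , refl) → k ⊕ j , ∈-⊕ K-sub kK jK , interchange k k j j }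
    ; ∈-⊖  = λ { (k , kK , refl) → ⊖ k , ∈-⊖ K-sub kK , sym (⁻¹-∙-comm k k) } }

  +ˢ-isSubgroupPred : ∀ {A B} → IsSubgroupPred A → IsSubgroupPred B → IsSubgroupPred (A +ˢ B)
  +ˢ-isSubgroupPred A-sub B-sub = record
    { ∈-0ℤ = 0ℤ , 0ℤ , ∈-0ℤ A-sub , ∈-0ℤ B-sub , sym (identityˡ 0ℤ)
    ; ∈-⊕  = λ { (a , b , aA , bB , refl) (a′ , b′ , a′A , b′B , refl) →
                 a ⊕ a′ , b ⊕ b′ , ∈-⊕ A-sub aA a′A , ∈-⊕ B-sub bB b′B , interchange a b a′ b′ }
    ; ∈-⊖  = λ { (a , b , aA , bB , refl) → ⊖ a , ⊖ b , ∈-⊖ A-sub aA , ∈-⊖ B-sub bB , sym (⁻¹-∙-comm a b) } }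

  twice⊆ : ∀ {K} → IsSubgroupPred K → twice K ⊆ K
  twice⊆ K-sub (k , k∈K , refl) = ∈-⊕ K-sub k∈K k∈K

  twice? : ∀ {K} → Decidable K → Decidable (twice K)
  twice? K? x = any? λ k → K? k ×-dec x ≟ k ⊕ k

  +ˢ? : ∀ {A B} → Decidable A → Decidable B → Decidable (A +ˢ B)
  +ˢ? A? B? x = any? λ a → any? λ b → A? a ×-dec B? b ×-dec x ≟ a ⊕ b

  -- Twisted automorphisms of the double cover

  twist : (Fin n → Fin n) → Fin n → Fin n × Bool → Fin n × Bool
  twist g k (v , false) = g v , false
  twist g k (v , true)  = g (v ⊕ k) ⊖ k , true

  twist-inverse : ∀ {g g⁻} k → StrictlyInverseʳ _≡_ g g⁻ → StrictlyInverseʳ _≡_ (twist g k) (twist g⁻ k)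
  twist-inverse k inv (v , false) = cong (_, false) (inv v)
  twist-inverse {g} {g⁻} k inv (v , true) = cong (_, true) (begin
    g⁻ ((g (v ⊕ k) ⊖ k) ⊕ k) ⊖ k    ≡⟨ cong (λ x → g⁻ x ⊖ k) (//-rightDividesˡ k (g (v ⊕ k))) ⟩
    g⁻ (g (v ⊕ k)) ⊖ k              ≡⟨ cong (_⊖ k) (inv (v ⊕ k)) ⟩
    (v ⊕ k) ⊖ k                     ≡⟨ //-rightDividesʳ k v ⟩
    v                               ∎)
    where open ≡-Reasoning

  twist-bijective : ∀ {g g⁻} k → StrictlyInverseˡ _≡_ g g⁻ → StrictlyInverseʳ _≡_ g g⁻ →
                    Bijective _≡_ _≡_ (twist g k)
  twist-bijective {g} {g⁻} k invˡ invʳ = Bijection.bijective (↔⇒⤖ (mk↔ₛ′ (twist g k) (twist g⁻ k)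
    (twist-inverse k invˡ) (twist-inverse k invʳ)))

  module _ {S : Subset n} (S-sym : ∀ s → s ∈ S → (⊖ s) ∈ S) where

    CayAdj-sym : ∀ {v w} → CayAdj S v w → CayAdj S w v
    CayAdj-sym {v} {w} vw = subst (_∈ S) (⁻¹-anti-homo‿- w v) (S-sym _ vw)

    CayAdj-sym-⇔ : ∀ {v w} → CayAdj S v w ⇔ CayAdj S w v
    CayAdj-sym-⇔ = mk⇔ CayAdj-sym CayAdj-sym

    twist-isAutomorphism : ∀ {g g⁻} k → StrictlyInverseˡ _≡_ g g⁻ → StrictlyInverseʳ _≡_ g g⁻ →
                           (∀ v w → CayAdj S v w ⇔ CayAdj S (g v) (g (w ⊕ k) ⊖ k)) →
                           IsAutomorphism (BAdj (CayAdj S)) (twist g k)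
    twist-isAutomorphism {g} k invˡ invʳ adj = twist-bijective k invˡ invʳ , preserves
      where
      preserves : ∀ u u′ → BAdj (CayAdj S) u u′ ⇔ BAdj (CayAdj S) (twist g k u) (twist g k u′)
      preserves (v , false) (w , false) = mk⇔ (λ ()) (λ ())
      preserves (v , true)  (w , true)  = mk⇔ (λ ()) (λ ())
      preserves (v , false) (w , true)  = ⇔-id _ ×-⇔ adj v w
      preserves (v , true)  (w , false) = ⇔-id _ ×-⇔ (CayAdj-sym-⇔ ⇔-∘ (adj w v ⇔-∘ CayAdj-sym-⇔))

  twist-∉AutX×S₂ : ∀ {S g} v k → g v ⊕ k ≢ g (v ⊕ k) → ¬ InAutXS2 (CayAdj S) (twist g k)
  twist-∉AutX×S₂ {g = g} v k moved (φ , σ , _ , _ , twist≡) = moved (begin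
    g v ⊕ k                  ≡⟨ cong (λ x → proj₁ x ⊕ k) (twist≡ v false) ⟩
    φ v ⊕ k                  ≡⟨ cong (λ x → proj₁ x ⊕ k) (twist≡ v true) ⟨
    (g (v ⊕ k) ⊖ k) ⊕ k      ≡⟨ //-rightDividesˡ k (g (v ⊕ k)) ⟩
    g (v ⊕ k)                ∎)
    where open ≡-Reasoning

  TranslatesCosets : Pred (Fin n) 0ℓ → (Fin n → Fin n) → Set
  TranslatesCosets C g = ∀ {a b} → C (a ⊖ b) → g a ⊖ g b ≡ a ⊖ b

  SeparatesCosets : Pred (Fin n) 0ℓ → (Fin n → Fin n) → Set
  SeparatesCosets C g = ∀ {a b} → ¬ C (a ⊖ b) → ¬ C (g a ⊖ g b)

  inverse-translates⇒separates : ∀ {C g g⁻} → StrictlyInverseʳ _≡_ g g⁻ →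
                                 TranslatesCosets C g⁻ → SeparatesCosets C g
  inverse-translates⇒separates {C} {g} {g⁻} inv g⁻-tr {a} {b} ¬ab gab =
    ¬ab (subst₂ (λ x y → C (x ⊖ y)) (inv a) (inv b) (subst C (sym (g⁻-tr gab)) gab))

  module _ {S : Subset n} {H C B : Pred (Fin n) 0ℓ} (H-sub : IsSubgroupPred H) (C? : Decidable C)
           {g : Fin n → Fin n} (g-∈H : ∀ a → H (g a ⊖ a))
           (g-tr : TranslatesCosets C g) (g-sep : SeparatesCosets C g)
           {k : Fin n} (B⇒C : ∀ {x} → B x → C (x ⊕ k))
           (S-closed : ((⟦ S ⟧ ∖ B) +ˢ H) ⊆ (⟦ S ⟧ ∪ B)) where

    S-step : ∀ {x y} → ¬ B x → ¬ B y → H (y ⊖ x) → x ∈ S → y ∈ S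
    S-step {x} {y} ¬Bx ¬By yx xS with S-closed (x , y ⊖ x , (xS , ¬Bx) , yx , sym (x⊕[y⊖x]≡y x y))
    ... | inj₁ yS = yS
    ... | inj₂ By = ⊥-elim (¬By By)

    twisted-adjacency : ∀ v w → CayAdj S v w ⇔ CayAdj S (g v) (g (w ⊕ k) ⊖ k)
    twisted-adjacency v w = by-cases (C? (u ⊖ v))
      where
      open ≡-Reasoning
      u x y : Fin n
      u = w ⊕ k
      x = w ⊖ v
      y = (g u ⊖ k) ⊖ g v

      x⊕k : x ⊕ k ≡ u ⊖ v
      x⊕k = xy∙z≈xz∙y w (⊖ v) k

      y⊕k : y ⊕ k ≡ g u ⊖ g v
      y⊕k = trans (xy∙z≈xz∙y (g u ⊖ k) (⊖ g v) k) (cong (_⊖ g v) (//-rightDividesˡ k (g u)))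

      y⊖x∈H : H (y ⊖ x)
      y⊖x∈H = subst H (begin
        (g u ⊖ u) ⊖ (g v ⊖ v)      ≡⟨ ⊖-interchange (g u) (g v) u v ⟨
        (g u ⊖ g v) ⊖ (u ⊖ v)      ≡⟨ cong₂ _⊖_ y⊕k x⊕k ⟨
        (y ⊕ k) ⊖ (x ⊕ k)          ≡⟨ ⊖-cancelʳ-⊕ y x k ⟩
        y ⊖ x                      ∎) (∈-diff H-sub (g-∈H u) (g-∈H v))

      by-cases : Dec (C (u ⊖ v)) → x ∈ S ⇔ y ∈ S
      by-cases (yes c) = mk⇔ (subst (_∈ S) (sym y≡x)) (subst (_∈ S) y≡x)
        where
        y≡x : y ≡ x
        y≡x = ∙-cancelʳ k y x (trans y⊕k (trans (g-tr c) (sym x⊕k)))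
      by-cases (no ¬c) = mk⇔ (S-step ¬Bx ¬By y⊖x∈H)
                             (S-step ¬By ¬Bx (subst H (⁻¹-anti-homo‿- y x) (∈-⊖ H-sub y⊖x∈H)))
        where
        ¬Bx : ¬ B x
        ¬Bx Bx = ¬c (subst C x⊕k (B⇒C Bx))
        ¬By : ¬ B y
        ¬By By = g-sep ¬c (subst C y⊕k (B⇒C By))

  module Exchange {C : Pred (Fin n) 0ℓ} (C-sub : IsSubgroupPred C) (C? : Decidable C) where

    displacement : Fin n → Fin n → Fin n
    displacement h a = if does (C? a) then h else if does (C? (a ⊖ h)) then ⊖ h else 0ℤ

    -- Translation by h on C, by ⊖ h on C ⊕ h, and the identity elsewhere:
    -- it swaps the cosets C and C ⊕ h when they differ.
    exchange : Fin n → Fin n → Fin n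
    exchange h a = a ⊕ displacement h a

    exchange-∈ : ∀ {h a} → C a → exchange h a ≡ a ⊕ h
    exchange-∈ {a = a} ca with C? a
    ... | yes _ = refl
    ... | no ¬ca = ⊥-elim (¬ca ca)

    exchange-∈ʰ : ∀ {h a} → ¬ C a → C (a ⊖ h) → exchange h a ≡ a ⊖ h
    exchange-∈ʰ {h} {a} ¬ca cah with C? a | C? (a ⊖ h)
    ... | yes ca | _       = ⊥-elim (¬ca ca)
    ... | no _   | yes _   = refl
    ... | no _   | no ¬cah = ⊥-elim (¬cah cah)

    exchange-∉ : ∀ {h a} → ¬ C a → ¬ C (a ⊖ h) → exchange h a ≡ a
    exchange-∉ {h} {a} ¬ca ¬cah with C? a | C? (a ⊖ h)
    ... | yes ca | _      = ⊥-elim (¬ca ca)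
    ... | no _   | yes ca = ⊥-elim (¬cah ca)
    ... | no _   | no _   = ⊕-identityʳ a

    does-coset : ∀ {a b} → C (a ⊖ b) → does (C? a) ≡ does (C? b)
    does-coset {a} {b} ab with C? b
    ... | yes cb  = dec-true (C? a) (∈-cosetʳ C-sub ab cb)
    ... | no ¬cb  = dec-false (C? a) (λ ca → ¬cb (∈-cosetˡ C-sub ab ca))

    displacement-coset : ∀ h {a b} → C (a ⊖ b) → displacement h a ≡ displacement h b
    displacement-coset h {a} {b} ab =
      cong₂ (λ p q → if p then h else if q then ⊖ h else 0ℤ)
            (does-coset ab) (does-coset (subst C (sym (⊖-cancelʳ-⊕ a b (⊖ h))) ab))

    exchange-translates : ∀ h → TranslatesCosets C (exchange h)
    exchange-translates h {a} {b} ab = begin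
      (a ⊕ δ a) ⊖ (b ⊕ δ b)   ≡⟨ ⊖-⊕-distrib a (δ a) b (δ b) ⟩
      (a ⊖ b) ⊕ (δ a ⊖ δ b)   ≡⟨ cong (λ z → (a ⊖ b) ⊕ (z ⊖ δ b)) (displacement-coset h ab) ⟩
      (a ⊖ b) ⊕ (δ b ⊖ δ b)   ≡⟨ cong ((a ⊖ b) ⊕_) (inverseʳ (δ b)) ⟩
      (a ⊖ b) ⊕ 0ℤ            ≡⟨ ⊕-identityʳ (a ⊖ b) ⟩
      a ⊖ b                   ∎
      where
      open ≡-Reasoning
      δ = displacement h

    exchange-displacement-∈ : ∀ {H} → IsSubgroupPred H → ∀ {h} → H h → ∀ a → H (exchange h a ⊖ a)
    exchange-displacement-∈ {H} H-sub {h} hH a =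
      subst H (sym ([x⊕y]⊖x≡y a (displacement h a))) displacement-∈
      where
      displacement-∈ : H (displacement h a)
      displacement-∈ with does (C? a) | does (C? (a ⊖ h))
      ... | true  | _     = hH
      ... | false | true  = ∈-⊖ H-sub hH
      ... | false | false = ∈-0ℤ H-sub

    exchange-involutive : ∀ {h} → ¬ C h → StrictlyInverseʳ _≡_ (exchange h) (exchange h)
    exchange-involutive {h} ¬ch a = by-cases (C? a) (C? (a ⊖ h))
      where
      by-cases : Dec (C a) → Dec (C (a ⊖ h)) → exchange h (exchange h a) ≡ a
      by-cases (yes ca) _ = begin
        exchange h (exchange h a)  ≡⟨ cong (exchange h) (exchange-∈ ca) ⟩
        exchange h (a ⊕ h)         ≡⟨ exchange-∈ʰ (λ c → ¬ch (subst C ([x⊕y]⊖x≡y a h) (∈-diff C-sub c ca)))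
                                                  (subst C (sym (//-rightDividesʳ h a)) ca) ⟩
        (a ⊕ h) ⊖ h                ≡⟨ //-rightDividesʳ h a ⟩
        a                          ∎
        where open ≡-Reasoning
      by-cases (no ¬ca) (yes cah) = begin
        exchange h (exchange h a)  ≡⟨ cong (exchange h) (exchange-∈ʰ ¬ca cah) ⟩
        exchange h (a ⊖ h)         ≡⟨ exchange-∈ cah ⟩
        (a ⊖ h) ⊕ h                ≡⟨ //-rightDividesˡ h a ⟩
        a                          ∎
        where open ≡-Reasoning
      by-cases (no ¬ca) (no ¬cah) = trans (cong (exchange h) (exchange-∉ ¬ca ¬cah)) (exchange-∉ ¬ca ¬cah)

    exchange-⊖-inverseʳ : ∀ {h} → C h → StrictlyInverseʳ _≡_ (exchange h) (exchange (⊖ h))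
    exchange-⊖-inverseʳ {h} ch a = by-cases (C? a)
      where
      by-cases : Dec (C a) → exchange (⊖ h) (exchange h a) ≡ a
      by-cases (yes ca) = begin
        exchange (⊖ h) (exchange h a)  ≡⟨ cong (exchange (⊖ h)) (exchange-∈ ca) ⟩
        exchange (⊖ h) (a ⊕ h)         ≡⟨ exchange-∈ (∈-⊕ C-sub ca ch) ⟩
        (a ⊕ h) ⊖ h                    ≡⟨ //-rightDividesʳ h a ⟩
        a                              ∎
        where open ≡-Reasoning
      by-cases (no ¬ca) = begin
        exchange (⊖ h) (exchange h a)
          ≡⟨ cong (exchange (⊖ h)) (exchange-∉ ¬ca (λ c → ¬ca (∈-cosetʳ C-sub c ch))) ⟩
        exchange (⊖ h) a
          ≡⟨ exchange-∉ ¬ca (λ c → ¬ca (∈-cosetʳ C-sub c (∈-⊖ C-sub ch))) ⟩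
        a                              ∎
        where open ≡-Reasoning

    exchange⁻¹ : Fin n → Fin n → Fin n
    exchange⁻¹ h = if does (C? h) then exchange (⊖ h) else exchange h

    exchange⁻¹-translates : ∀ h → TranslatesCosets C (exchange⁻¹ h)
    exchange⁻¹-translates h with does (C? h)
    ... | true  = exchange-translates (⊖ h)
    ... | false = exchange-translates h

    exchange-inverseʳ : ∀ h → StrictlyInverseʳ _≡_ (exchange h) (exchange⁻¹ h)
    exchange-inverseʳ h with C? h
    ... | yes ch  = exchange-⊖-inverseʳ ch
    ... | no ¬ch  = exchange-involutive ¬ch

    exchange-inverseˡ : ∀ h → StrictlyInverseˡ _≡_ (exchange h) (exchange⁻¹ h)
    exchange-inverseˡ h with C? h
    ... | yes ch  = subst (λ h′ → StrictlyInverseʳ _≡_ (exchange (⊖ h)) (exchange h′))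
                          (⁻¹-involutive h) (exchange-⊖-inverseʳ (∈-⊖ C-sub ch))
    ... | no ¬ch  = exchange-involutive ¬ch

    exchange-separates : ∀ h → SeparatesCosets C (exchange h)
    exchange-separates h = inverse-translates⇒separates {C} (exchange-inverseʳ h) (exchange⁻¹-translates h)

    exchange-not-⊕-equivariant : ∀ {h k} → h ≢ 0ℤ → (C (k ⊖ h) → h ⊕ h ≢ 0ℤ) → ¬ C k →
                     exchange h 0ℤ ⊕ k ≢ exchange h (0ℤ ⊕ k)
    exchange-not-⊕-equivariant {h} {k} h≢0 ch-h ¬ck eq = by-cases (C? (k ⊖ h))
      where
      h⊕k≡ : h ⊕ k ≡ exchange h k
      h⊕k≡ = begin
        h ⊕ k                  ≡⟨ cong (_⊕ k) (identityˡ h) ⟨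
        (0ℤ ⊕ h) ⊕ k           ≡⟨ cong (_⊕ k) (exchange-∈ (∈-0ℤ C-sub)) ⟨
        exchange h 0ℤ ⊕ k      ≡⟨ eq ⟩
        exchange h (0ℤ ⊕ k)    ≡⟨ cong (exchange h) (identityˡ k) ⟩
        exchange h k           ∎
        where open ≡-Reasoning
      by-cases : Dec (C (k ⊖ h)) → ⊥
      by-cases (yes ckh) = ch-h ckh (trans (cong (h ⊕_) h≡⊖h) (inverseʳ h))
        where
        h≡⊖h : h ≡ ⊖ h
        h≡⊖h = ∙-cancelʳ k h (⊖ h) (trans h⊕k≡ (trans (exchange-∈ʰ ¬ck ckh) (⊕-comm k (⊖ h))))
      by-cases (no ¬ckh) = h≢0 (∙-cancelʳ k h 0ℤ (trans h⊕k≡ (trans (exchange-∉ ¬ck ¬ckh) (sym (identityˡ k)))))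

  unstable-by-exchange :
    ∀ {S : Subset n} {H C B : Pred (Fin n) 0ℓ} {h k : Fin n} →
    (∀ s → s ∈ S → (⊖ s) ∈ S) → IsSubgroupPred H → IsSubgroupPred C → Decidable C →
    H h → h ≢ 0ℤ → ¬ C k → (C (k ⊖ h) → h ⊕ h ≢ 0ℤ) →
    (∀ {x} → B x → C (x ⊕ k)) → ((⟦ S ⟧ ∖ B) +ˢ H) ⊆ (⟦ S ⟧ ∪ B) →
    Unstable (CayAdj S)
  unstable-by-exchange {h = h} {k} S-sym H-sub C-sub C? hH h≢0 ¬ck ckh B⇒C S-closed =
    twist (exchange h) k ,
    twist-isAutomorphism S-sym k (exchange-inverseˡ h) (exchange-inverseʳ h)
      (twisted-adjacency H-sub C? (exchange-displacement-∈ H-sub hH)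
                         (exchange-translates h) (exchange-separates h) B⇒C S-closed) ,
    twist-∉AutX×S₂ 0ℤ k (exchange-not-⊕-equivariant h≢0 ckh ¬ck)
    where open Exchange C-sub C?

  -- Cyclic subgroups of ℤₙ

  toℕ≡0⇒≡0ℤ : ∀ {x : Fin n} → toℕ x ≡ 0 → x ≡ 0ℤ
  toℕ≡0⇒≡0ℤ eq = toℕ-injective (trans eq (sym toℕ-0ℤ))

  mod-∸ : ∀ a b → (a + b) mod n ⊖ (b mod n) ≡ a mod n
  mod-∸ a b = trans (cong (_⊖ (b mod n)) (sym (mod-+ a b))) (//-rightDividesʳ (b mod n) (a mod n))

  double≡0ℤ⇒toℕ+toℕ≡n : ∀ {x : Fin n} → x ≢ 0ℤ → x ⊕ x ≡ 0ℤ → toℕ x + toℕ x ≡ n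
  double≡0ℤ⇒toℕ+toℕ≡n {x} x≢0 x⊕x≡0
    with m%n≡0⇒n∣m (toℕ x + toℕ x) n (trans (sym (toℕ-mod _)) (trans (cong toℕ x⊕x≡0) toℕ-0ℤ))
  ... | divides zero          eq = ⊥-elim (x≢0 (toℕ≡0⇒≡0ℤ (m+n≡0⇒m≡0 (toℕ x) eq)))
  ... | divides (suc zero)    eq = trans eq (+-identityʳ n)
  ... | divides (suc (suc c)) eq = ⊥-elim (<⇒≱ (+-mono-< (toℕ<n x) (toℕ<n x))
                                               (subst (n + n ≤_) (sym eq) (+-monoʳ-≤ n (m≤m+n n (c * n)))))

  module Generator {K : Subset n} (K-sub : IsSubgroupPred ⟦ K ⟧) (K-nt : Nontrivial K) where

    private
      -- γ is the least i violating i ∈ K → i ≡ 0ℤ, that is, the least nonzero element of K.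
      least : ∃ λ γ → ¬ (γ ∈ K → γ ≡ 0ℤ) × (∀ (j : Fin′ γ) → inject j ∈ K → inject j ≡ 0ℤ)
      least = ¬∀⟶∃¬-smallest n _ (λ i → (i ∈? K) →-dec (i ≟ 0ℤ))
                              (λ trivial → let (h , h∈K , h≢0) = K-nt in h≢0 (trivial h h∈K))

    γ : Fin n
    γ = proj₁ least

    γ∈K : γ ∈ K
    γ∈K = decidable-stable (γ ∈? K) (λ γ∉K → proj₁ (proj₂ least) (λ γ∈K → ⊥-elim (γ∉K γ∈K)))

    γ≢0ℤ : γ ≢ 0ℤ
    γ≢0ℤ γ≡0 = proj₁ (proj₂ least) (λ _ → γ≡0)

    g : ℕ
    g = toℕ γ

    instance
      g-nonZero : NonZero g
      g-nonZero = ℕ.≢-nonZero (γ≢0ℤ ∘ toℕ≡0⇒≡0ℤ)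

    g-least : ∀ r → r < g → r mod n ∈ K → r ≡ 0
    g-least r r<g r∈K = begin
      r                  ≡⟨ toℕ-fromℕ< r<g ⟨
      toℕ j              ≡⟨ toℕ-inject j ⟨
      toℕ (inject j)     ≡⟨ cong toℕ (proj₂ (proj₂ least) j (subst (_∈ K) (sym j≡r) r∈K)) ⟩
      toℕ (0ℤ {n})       ≡⟨ toℕ-0ℤ ⟩
      0                  ∎
      where
      open ≡-Reasoning
      j : Fin′ γ
      j = fromℕ< r<g
      j≡r : inject j ≡ r mod n
      j≡r = toℕ-injective (trans (toℕ-inject j) (trans (toℕ-fromℕ< r<g)
              (sym (trans (toℕ-mod r) (m<n⇒m%n≡m (<-trans r<g (toℕ<n γ)))))))

    multiple-∈ : ∀ j → (j * g) mod n ∈ K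
    multiple-∈ zero    = ∈-0ℤ K-sub
    multiple-∈ (suc j) =
      subst (_∈ K) (trans (cong (_⊕ ((j * g) mod n)) (sym (toℕ-mod-id γ))) (mod-+ g (j * g)))
                   (∈-⊕ K-sub γ∈K (multiple-∈ j))

    mod-∈⇒∣ : ∀ t → t mod n ∈ K → g ∣ t
    mod-∈⇒∣ t t∈K = m%n≡0⇒n∣m t g (g-least (t % g) (m%n<n t g) r∈K)
      where
      r∈K : (t % g) mod n ∈ K
      r∈K = subst (_∈ K) (trans (cong (λ z → z mod n ⊖ ((t / g * g) mod n)) (m≡m%n+[m/n]*n t g))
                                (mod-∸ (t % g) (t / g * g)))
                         (∈-diff K-sub t∈K (multiple-∈ (t / g)))

    ∈⇔∣ : ∀ x → x ∈ K ⇔ g ∣ toℕ x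
    ∈⇔∣ x = mk⇔ (λ x∈K → mod-∈⇒∣ (toℕ x) (subst (_∈ K) (sym (toℕ-mod-id x)) x∈K))
                (λ { (divides j eq) →
                     subst (_∈ K) (trans (cong (_mod n) (sym eq)) (toℕ-mod-id x)) (multiple-∈ j) })

    g∣n : g ∣ n
    g∣n = mod-∈⇒∣ n (subst (_∈ K) (sym n-mod) (∈-0ℤ K-sub))

    index : ℕ
    index = quotient g∣n

    ∣K∣≡index : ∣ K ∣ ≡ index
    ∣K∣≡index = begin
      ∣ K ∣                                   ≡⟨ ∣p∣≡count< (g ∣?_) K ∈⇔∣ ⟩
      count< (λ v → does (g ∣? v)) n          ≡⟨ cong (count< _) (equality g∣n) ⟩
      count< (λ v → does (g ∣? v)) (index * g) ≡⟨ count<-multiples g index ⟩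
      index                                   ∎
      where open ≡-Reasoning

    index-of-involution : ∀ {x} j → x ≢ 0ℤ → x ⊕ x ≡ 0ℤ → toℕ x ≡ j * g → j + j ≡ index
    index-of-involution {x} j x≢0 x⊕x≡0 x≡jg = *-cancelʳ-≡ (j + j) index g (begin
      (j + j) * g            ≡⟨ *-distribʳ-+ g j j ⟩
      j * g + j * g          ≡⟨ cong₂ _+_ x≡jg x≡jg ⟨
      toℕ x + toℕ x          ≡⟨ double≡0ℤ⇒toℕ+toℕ≡n x≢0 x⊕x≡0 ⟩
      n                      ≡⟨ equality g∣n ⟩
      index * g              ∎)
      where open ≡-Reasoning

    ⊆⁅0,h⁆⇒∣K∣≡2 : ∀ {h} → (∀ x → x ∈ K → x ≡ 0ℤ ⊎ x ≡ h) → ∣ K ∣ ≡ 2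
    ⊆⁅0,h⁆⇒∣K∣≡2 {h} ⊆⁅0,h⁆ =
      trans ∣K∣≡index (sym (index-of-involution 1 γ≢0ℤ γ⊕γ≡0 (sym (*-identityˡ g))))
      where
      γ≡h : γ ≡ h
      γ≡h with ⊆⁅0,h⁆ γ γ∈K
      ... | inj₁ γ≡0 = ⊥-elim (γ≢0ℤ γ≡0)
      ... | inj₂ γ≡h = γ≡h
      γ⊕γ≡0 : γ ⊕ γ ≡ 0ℤ
      γ⊕γ≡0 with ⊆⁅0,h⁆ (γ ⊕ γ) (∈-⊕ K-sub γ∈K γ∈K)
      ... | inj₁ γ⊕γ≡0 = γ⊕γ≡0
      ... | inj₂ γ⊕γ≡h =
        ⊥-elim (γ≢0ℤ (∙-cancelʳ γ γ 0ℤ (trans γ⊕γ≡h (trans (sym γ≡h) (sym (identityˡ γ))))))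

  module OddPart {K : Subset n} (K-sub : IsSubgroupPred ⟦ K ⟧) (K-nt : Nontrivial K) where
    open Generator K-sub K-nt

    private
      2K Kₒ : Pred (Fin n) 0ℓ
      2K = twice ⟦ K ⟧
      Kₒ = odd-part ⟦ K ⟧

    2g∣⇒mod-∈2K : ∀ t → 2 * g ∣ t → 2K (t mod n)
    2g∣⇒mod-∈2K t (divides j refl) = (j * g) mod n , multiple-∈ j ,
      trans (cong (_mod n) (m*[2*n]≡m*n+m*n j g)) (sym (mod-+ (j * g) (j * g)))

    Kₒ⇒odd-multiple : ∀ {x} → Kₒ x → ∃[ α ] (toℕ x ≡ α * g × ¬ 2 ∣ α)
    Kₒ⇒odd-multiple {x} (x∈K , x∉2K) with Equivalence.to (∈⇔∣ x) x∈K
    ... | divides α x≡αg = α , x≡αg , λ { (divides β refl) →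
      x∉2K (subst 2K (toℕ-mod-id x) (2g∣⇒mod-∈2K (toℕ x) (divides β (trans x≡αg (*-assoc β 2 g))))) }

    Kₒ⊕Kₒ⊆2K : ∀ {a b} → Kₒ a → Kₒ b → 2K (a ⊕ b)
    Kₒ⊕Kₒ⊆2K {a} {b} a∈Kₒ b∈Kₒ with Kₒ⇒odd-multiple a∈Kₒ | Kₒ⇒odd-multiple b∈Kₒ
    ... | α , a≡αg , α-odd | β , b≡βg , β-odd with ¬2∣m⇒¬2∣n⇒2∣m+n α β α-odd β-odd
    ...   | divides c α+β≡c*2 = 2g∣⇒mod-∈2K (toℕ a + toℕ b) (divides c (begin
      toℕ a + toℕ b     ≡⟨ cong₂ _+_ a≡αg b≡βg ⟩
      α * g + β * g     ≡⟨ *-distribʳ-+ g α β ⟨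
      (α + β) * g       ≡⟨ cong (_* g) α+β≡c*2 ⟩
      c * 2 * g         ≡⟨ *-assoc c 2 g ⟩
      c * (2 * g)       ∎))
      where open ≡-Reasoning

    Kₒ⊕2K⊆Kₒ : ∀ {a e} → Kₒ a → 2K e → Kₒ (a ⊕ e)
    Kₒ⊕2K⊆Kₒ {a} {e} (a∈K , a∉2K) e∈2K =
      ∈-⊕ K-sub a∈K (twice⊆ K-sub e∈2K) ,
      λ a⊕e∈2K → a∉2K (subst 2K (//-rightDividesʳ e a) (∈-diff 2K-sub a⊕e∈2K e∈2K))
      where 2K-sub = twice-isSubgroupPred K-sub

    γ∈Kₒ : 2 ∣ ∣ K ∣ → Kₒ γ
    γ∈Kₒ 2∣∣K∣ = γ∈K , λ { (k , k∈K , γ≡k⊕k) → <⇒≱ (g<2g) (∣⇒≤ (2g∣g k k∈K γ≡k⊕k)) }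
      where
      g<2g : g < 2 * g
      g<2g = subst (g <_) (sym (cong (g +_) (+-identityʳ g))) (m<m+n g (ℕ.>-nonZero⁻¹ g))
      2g∣n : 2 * g ∣ n
      2g∣n with subst (2 ∣_) ∣K∣≡index 2∣∣K∣
      ... | divides c index≡c*2 =
        divides c (trans (equality g∣n) (trans (cong (_* g) index≡c*2) (*-assoc c 2 g)))
      2g∣g : ∀ k → k ∈ K → γ ≡ k ⊕ k → 2 * g ∣ g
      2g∣g k k∈K γ≡k⊕k with Equivalence.to (∈⇔∣ k) k∈K
      ... | divides j k≡jg = subst (2 * g ∣_) (sym (trans (cong toℕ γ≡k⊕k) (toℕ-mod _)))
              (%-presˡ-∣ (divides j (trans (cong₂ _+_ k≡jg k≡jg) (sym (m*[2*n]≡m*n+m*n j g)))) 2g∣n)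

    Kₒ-involution : ∀ {x} → Kₒ x → x ⊕ x ≡ 0ℤ → ¬ 4 ∣ ∣ K ∣
    Kₒ-involution {x} x∈Kₒ x⊕x≡0 (divides c ∣K∣≡c*4) with Kₒ⇒odd-multiple x∈Kₒ
    ... | α , x≡αg , α-odd = α-odd (m+m≡c*4⇒2∣m α c
      (trans (index-of-involution α x≢0 x⊕x≡0 x≡αg) (trans (sym ∣K∣≡index) ∣K∣≡c*4)))
      where
      x≢0 : x ≢ 0ℤ
      x≢0 x≡0 = proj₂ x∈Kₒ (subst 2K (sym x≡0) (∈-0ℤ (twice-isSubgroupPred K-sub)))

  module _ {S H K : Subset n} (S-sym : ∀ s → s ∈ S → (⊖ s) ∈ S)
           (H-sub : IsSubgroupPred ⟦ H ⟧)
           (K-sub : IsSubgroupPred ⟦ K ⟧) (K-nt : Nontrivial K) where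
    open OddPart K-sub K-nt
    open Generator K-sub K-nt using (γ; γ∈K)

    private
      2K-sub : IsSubgroupPred (twice ⟦ K ⟧)
      2K-sub = twice-isSubgroupPred K-sub

    OddInvolution : Pred (Fin n) 0ℓ
    OddInvolution x = odd-part ⟦ K ⟧ x × x ⊕ x ≡ 0ℤ

    OddInvolution? : Decidable OddInvolution
    OddInvolution? x = ((x ∈? K) ×-dec ¬? (twice? (_∈? K) x)) ×-dec (x ⊕ x ≟ 0ℤ)

    -- If h₁ and another nonzero x ∈ H are odd involutions, then h₁ ⊕ x ∈ 2K will do;
    -- if h₁ is one and there is no such x, then H = {0, h₁}.
    ∃∈H-¬OddInvolution : Nontrivial H → ∣ H ∣ ≢ 2 ⊎ 4 ∣ ∣ K ∣ → ∃[ h ] (h ∈ H × h ≢ 0ℤ × ¬ OddInvolution h)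
    ∃∈H-¬OddInvolution (h₁ , h₁∈H , h₁≢0) H≢2⊎4∣K with OddInvolution? h₁
    ...   | no ¬inv₁ = h₁ , h₁∈H , h₁≢0 , ¬inv₁
    ...   | yes inv₁ with any? (λ x → (x ∈? H) ×-dec ¬? (x ≟ 0ℤ) ×-dec ¬? (x ≟ h₁))
    ...     | no H⊆⁅0,h₁⁆ =
      ⊥-elim ([ (λ H≢2 → H≢2 (Generator.⊆⁅0,h⁆⇒∣K∣≡2 H-sub (h₁ , h₁∈H , h₁≢0) H-members))
              , Kₒ-involution (proj₁ inv₁) (proj₂ inv₁) ] H≢2⊎4∣K)
      where
      H-members : ∀ x → x ∈ H → x ≡ 0ℤ ⊎ x ≡ h₁
      H-members x x∈H with x ≟ 0ℤ | x ≟ h₁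
      ... | yes x≡0 | _        = inj₁ x≡0
      ... | no _    | yes x≡h₁ = inj₂ x≡h₁
      ... | no x≢0  | no x≢h₁  = ⊥-elim (H⊆⁅0,h₁⁆ (x , x∈H , x≢0 , x≢h₁))
    ...     | yes (x , x∈H , x≢0 , x≢h₁) with OddInvolution? x
    ...       | no ¬inv = x , x∈H , x≢0 , ¬inv
    ...       | yes inv = h₁ ⊕ x , ∈-⊕ H-sub h₁∈H x∈H , h₁⊕x≢0 ,
                          λ (h₁⊕x∈Kₒ , _) → proj₂ h₁⊕x∈Kₒ (Kₒ⊕Kₒ⊆2K (proj₁ inv₁) (proj₁ inv))
      where
      h₁⊕x≢0 : h₁ ⊕ x ≢ 0ℤ
      h₁⊕x≢0 h₁⊕x≡0 = x≢h₁ (trans (inverseʳ-unique h₁ x h₁⊕x≡0) (sym (inverseʳ-unique h₁ h₁ (proj₂ inv₁))))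

    unstable-case₁ : Nontrivial H → (⟦ S ⟧ +ˢ ⟦ H ⟧) ⊆ (⟦ S ⟧ ∪ (odd-part ⟦ K ⟧ +ˢ ⟦ H ⟧)) →
                     (⟦ H ⟧ ∩ odd-part ⟦ K ⟧) ⊆ ∅ → 2 ∣ ∣ K ∣ → Unstable (CayAdj S)
    unstable-case₁ (h , h∈H , h≢0) S+H⊆ H∩Kₒ⊆∅ 2∣∣K∣ =
      unstable-by-exchange S-sym H-sub C-sub (+ˢ? (twice? (_∈? K)) (_∈? H)) h∈H h≢0
        γ∉C (λ c → ⊥-elim (γ∉C (∈-cosetʳ C-sub c h∈C))) B⇒C
        (λ { (s , d , (s∈S , _) , d∈H , eq) → S+H⊆ (s , d , s∈S , d∈H , eq) })
      where
      C-sub : IsSubgroupPred (twice ⟦ K ⟧ +ˢ ⟦ H ⟧)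
      C-sub = +ˢ-isSubgroupPred 2K-sub H-sub
      h∈C : (twice ⟦ K ⟧ +ˢ ⟦ H ⟧) h
      h∈C = 0ℤ , h , ∈-0ℤ 2K-sub , h∈H , sym (identityˡ h)
      γ∉C : ¬ (twice ⟦ K ⟧ +ˢ ⟦ H ⟧) γ
      γ∉C (e , b , e∈2K , b∈H , γ≡e⊕b) =
        H∩Kₒ⊆∅ (b∈H , subst (odd-part ⟦ K ⟧) (trans (cong (_⊖ e) γ≡e⊕b) ([x⊕y]⊖x≡y e b))
                             (Kₒ⊕2K⊆Kₒ (γ∈Kₒ 2∣∣K∣) (∈-⊖ 2K-sub e∈2K)))
      B⇒C : ∀ {x} → (odd-part ⟦ K ⟧ +ˢ ⟦ H ⟧) x → (twice ⟦ K ⟧ +ˢ ⟦ H ⟧) (x ⊕ γ)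
      B⇒C (a , b , a∈Kₒ , b∈H , refl) = a ⊕ γ , b , Kₒ⊕Kₒ⊆2K a∈Kₒ (γ∈Kₒ 2∣∣K∣) , b∈H , xy∙z≈xz∙y a b γ

    unstable-case₂ : Nontrivial H → ((⟦ S ⟧ ∖ odd-part ⟦ K ⟧) +ˢ ⟦ H ⟧) ⊆ (⟦ S ⟧ ∪ odd-part ⟦ K ⟧) →
                     ∣ H ∣ ≢ 2 ⊎ 4 ∣ ∣ K ∣ → 2 ∣ ∣ K ∣ → Unstable (CayAdj S)
    unstable-case₂ H-nt S∖Kₒ+H⊆ H≢2⊎4∣K 2∣∣K∣ with ∃∈H-¬OddInvolution H-nt H≢2⊎4∣K
    ... | h , h∈H , h≢0 , ¬inv =
      unstable-by-exchange S-sym H-sub 2K-sub (twice? (_∈? K)) h∈H h≢0 γ∉2K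
        (λ c h⊕h≡0 → ¬inv ((∈-cosetˡ K-sub (twice⊆ K-sub c) γ∈K ,
                            λ h∈2K → γ∉2K (∈-cosetʳ 2K-sub c h∈2K)) , h⊕h≡0))
        (λ x∈Kₒ → Kₒ⊕Kₒ⊆2K x∈Kₒ (γ∈Kₒ 2∣∣K∣)) S∖Kₒ+H⊆
      where
      γ∉2K : ¬ twice ⟦ K ⟧ γ
      γ∉2K = proj₂ (γ∈Kₒ 2∣∣K∣)

theorem3p2 : (n : ℕ) .{{_ : NonZero n}} (S H K : Subset n) →
    IsConnectionSet S →
    IsSubgroup H → Nontrivial H →
    IsSubgroup K → Nontrivial K → 2 ∣ ∣ K ∣ →
    ((((⟦ S ⟧ +ˢ ⟦ H ⟧) ⊆ (⟦ S ⟧ ∪ (odd-part ⟦ K ⟧ +ˢ ⟦ H ⟧)))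
        × ((⟦ H ⟧ ∩ odd-part ⟦ K ⟧) ⊆ ∅))
     ⊎ ((((⟦ S ⟧ ∖ odd-part ⟦ K ⟧) +ˢ ⟦ H ⟧) ⊆ (⟦ S ⟧ ∪ odd-part ⟦ K ⟧))
        × (∣ H ∣ ≢ 2 ⊎ 4 ∣ ∣ K ∣))) →
    Unstable (CayAdj S)
theorem3p2 n S H K (S-sym , _) H-sub H-nt K-sub K-nt 2∣∣K∣ (inj₁ (S+H⊆ , H∩Kₒ⊆∅)) =
  unstable-case₁ S-sym (isSubgroupPred H-sub) (isSubgroupPred K-sub) K-nt H-nt S+H⊆ H∩Kₒ⊆∅ 2∣∣K∣
theorem3p2 n S H K (S-sym , _) H-sub H-nt K-sub K-nt 2∣∣K∣ (inj₂ (S∖Kₒ+H⊆ , H≢2⊎4∣K)) =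
  unstable-case₂ S-sym (isSubgroupPred H-sub) (isSubgroupPred K-sub) K-nt H-nt S∖Kₒ+H⊆ H≢2⊎4∣K 2∣∣K∣
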